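{- Let $D>1$ be squarefree, let $u=A+B\sqrt{D}\in\mathcal{S}_D$, let $C=C(u)$, and let $Q=\gcd(A,B/C)$. Let $q$ be a prime dividing $Q$, and write $s=v_q(A)$ and $r=v_q(B/C)$, where $v_q(n)$ is the exponent of the largest power of $q$ dividing $n$. If either $q>2$, or $q=2$ and $2\mid D$, then $s>r$. If $q=2$ and $2\nmid D$, then $s=r$.
   Context: For squarefree $D>1$, let $\mathcal{O}$ be the ring of integers of $\mathbb{Q}(\sqrt{D})$. The set $\mathcal{S}_D$ consists of those $u=A+B\sqrt{D}$ with $A,B\in\mathbb{Z}$ such that the norm $N(u)=A^2-B^2D$ is the cube of an integer, $u$ is not a cube in $\mathcal{O}$, and $\gcd(A,B)$ is not divisible by the cube of any prime. For $u\in\mathcal{S}_D$, $C(u)$ is the product of the distinct odd primes that divide $\gcd(A,B)$ but do not divide $D$ (so $C\mid B$). -}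

module Defs where

open import Data.Nat as ℕ using (ℕ; zero; suc; _^_)
open import Data.Nat.Divisibility as ℕD using (_∣?_)
open import Data.Nat.Primality using (Prime; prime?)
open import Data.Bool using (Bool; true; false; if_then_else_; _∧_; not)
open import Data.Integer as ℤ using (ℤ; +_; ∣_∣)
open import Data.Integer.GCD using (gcd)
open import Data.Integer.Divisibility renaming (_∣_ to _∣ℤ_)
open import Data.Product using (∃; _×_; Σ)
open import Relation.Nullary using (¬_; isYes)
open import Relation.Binary.PropositionalEquality using (_≡_)

Squarefree : ℕ → Set
Squarefree D = ∀ (p : ℕ) → Prime p → ¬ (p ^ 2 ℕD.∣ D)

IsCubeℤ : ℤ → Set
IsCubeℤ n = ∃ λ (m : ℤ) → n ≡ m ℤ.* m ℤ.* m

-- Ring of integers of Q(√D), D squarefree, D > 1: its elements are exactly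
-- (a + b√D)/2 with a, b ∈ ℤ such that
--   a ≡ b (mod 2)      if D ≡ 1 (mod 4),
--   a, b both even     otherwise.
InO : ℕ → ℤ → ℤ → Set
InO D a b with D ℕ.% 4
... | 1 = (+ 2) ∣ℤ (a ℤ.- b)
... | _ = ((+ 2) ∣ℤ a) × ((+ 2) ∣ℤ b)

-- A + B√D is a cube in the ring of integers: A + B√D = ((a + b√D)/2)^3 with
-- (a + b√D)/2 ∈ O.  Expanding, ((a+b√D)/2)^3 = (a³ + 3ab²D + (3a²b + b³D)√D)/8.
IsCubeInO : ℕ → ℤ → ℤ → Set
IsCubeInO D A B = Σ ℤ λ a → Σ ℤ λ b →
  InO D a b ×
  ((+ 8) ℤ.* A ≡ a ℤ.* a ℤ.* a ℤ.+ (+ 3) ℤ.* a ℤ.* b ℤ.* b ℤ.* (+ D)) ×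
  ((+ 8) ℤ.* B ≡ (+ 3) ℤ.* a ℤ.* a ℤ.* b ℤ.+ b ℤ.* b ℤ.* b ℤ.* (+ D))

norm : ℕ → ℤ → ℤ → ℤ
norm D A B = A ℤ.* A ℤ.- B ℤ.* B ℤ.* (+ D)

InS : ℕ → ℤ → ℤ → Set
InS D A B =
  IsCubeℤ (norm D A B) ×
  ¬ IsCubeInO D A B ×
  (∀ (p : ℕ) → Prime p → ¬ ((+ (p ^ 3)) ∣ℤ gcd A B))

cTest : ℕ → ℕ → ℕ → Bool
cTest D g p =
  isYes (prime? p) ∧ not (isYes (2 ∣? p)) ∧ isYes (p ∣? g) ∧ not (isYes (p ∣? D))

cProd : ℕ → ℕ → ℕ → ℕ
cProd D g zero = 1
cProd D g (suc n) = (if cTest D g n then n else 1) ℕ.* cProd D g n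

-- C(u): product of the distinct odd primes dividing gcd(A,B) but not D.
-- (All such primes are ≤ ∣gcd(A,B)∣ when gcd(A,B) ≠ 0, which holds on S_D.)
Cof : ℕ → ℤ → ℤ → ℕ
Cof D A B = cProd D ∣ gcd A B ∣ (suc ∣ gcd A B ∣)

IsVal : ℕ → ℤ → ℕ → Set
IsVal q n s = ((+ (q ^ s)) ∣ℤ n) × ¬ ((+ (q ^ suc s)) ∣ℤ n)

{-# OPTIONS --safe #-}
module Submission where

-- Let v be the q-adic valuation.  In A² − B²D = m³, a term of strictly smaller
-- valuation than the other one fixes v(m³), a multiple of 3.  If that term is A²
-- (valuation 2s), or B²D with q ∤ D (valuation 2 v(B)), then 3 ∣ s resp.
-- 3 ∣ v(B), so q³ divides both A and B, contradicting the cube-freeness of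
-- gcd(A,B).  When s ≤ r, A² is the smaller term as soon as q ∣ D or q ∣ C, and
-- one of these holds when q is odd or q = 2 ∣ D; hence s > r.  When q = 2 ∤ D,
-- C is odd, so v(B) = r and neither term may be the smaller one: s = r.

open import Defs
open import Data.Nat using (ℕ; _>_)
open import Data.Nat.Primality using (Prime)
open import Data.Integer using (ℤ; +_; _*_)
open import Data.Integer.Divisibility using (_∣_)
open import Data.Integer.GCD using (gcd)
open import Data.Sum using (_⊎_)
open import Data.Product using (_×_)
open import Relation.Nullary using (¬_)
open import Relation.Binary.PropositionalEquality using (_≡_)

open import Data.Bool using (true; false; if_then_else_)
open import Data.Empty using (⊥; ⊥-elim)
open import Data.Nat as ℕ using (suc; ≢-nonZero; _+_; _^_; _≤_; _<_; NonZero; z≤n; s≤s)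
open import Data.Nat.Divisibility as ℕ using (divides; _∣?_)
open import Data.Nat.Properties
  using (≤-refl; <-irrefl; <⇒≤; n≤1+n; +-monoʳ-≤; ≰⇒>; <-cmp; +-suc; +-identityʳ; *-comm; *-identityʳ;
         m<1+n⇒m<n∨m≡n; ^-distribˡ-+-*; m^n≢0; [m*n]*[o*p]≡[m*o]*[n*p])
open import Data.Nat.Primality using (prime?; prime[2]; euclidsLemma; prime⇒nonZero; prime⇒irreducible)
open import Data.Nat.Tactic.RingSolver using (solve-∀)
import Data.Integer as ℤ
import Data.Integer.Properties as ℤ
import Data.Integer.Divisibility.Signed as ℤ
open import Data.Integer.GCD using (gcd[i,j]∣i; gcd[i,j]∣j; gcd-greatest)
open import Data.Product using (_,_; proj₁)
open import Data.Sum using (inj₁; inj₂; [_,_]′; reduce; map₂)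
open import Function using (_∘_)
open import Relation.Nullary using (yes; no; contradiction)
open import Relation.Nullary.Decidable using (from-yes)
open import Relation.Binary.Definitions using (tri<; tri≈; tri>)
open import Relation.Binary.PropositionalEquality using (refl; sym; trans; cong; subst; subst₂)

^-monoʳ-∣ : ∀ p {k l} → k ≤ l → p ^ k ℕ.∣ p ^ l
^-monoʳ-∣ p {l = l} z≤n       = ℕ.1∣ (p ^ l)
^-monoʳ-∣ p         (s≤s k≤l) = ℕ.*-monoʳ-∣ p (^-monoʳ-∣ p k≤l)

[k*p]³≡p^3*k³ : ∀ k p → k ℕ.* p ℕ.* (k ℕ.* p) ℕ.* (k ℕ.* p) ≡ p ^ 3 ℕ.* (k ℕ.* k ℕ.* k)
[k*p]³≡p^3*k³ = expanded
  where
  -- the ring solver cannot normalise _^_, so p ^ 3 is unfolded by hand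
  expanded : ∀ k p → k ℕ.* p ℕ.* (k ℕ.* p) ℕ.* (k ℕ.* p) ≡ p ℕ.* (p ℕ.* (p ℕ.* 1)) ℕ.* (k ℕ.* k ℕ.* k)
  expanded = solve-∀

3∣n+n⇒3∣n : ∀ n → 3 ℕ.∣ n + n → 3 ℕ.∣ n
3∣n+n⇒3∣n n 3∣n+n
  with euclidsLemma 2 n (from-yes (prime? 3)) (subst (3 ℕ.∣_) (cong (λ k → n + k) (sym (+-identityʳ n))) 3∣n+n)
... | inj₁ 3∣2 = contradiction 3∣2 (ℕ.>⇒∤ ≤-refl)
... | inj₂ 3∣n = 3∣n

p^[1+e]∤a*p^e⇒p∤a : ∀ {p a} e → ¬ p ^ suc e ℕ.∣ a ℕ.* p ^ e → ¬ p ℕ.∣ a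
p^[1+e]∤a*p^e⇒p∤a {p} e ∤ = ∤ ∘ ℕ.*-monoˡ-∣ (p ^ e)

module _ {p : ℕ} (p-prime : Prime p) where
  private instance
    p≢0 : NonZero p
    p≢0 = prime⇒nonZero p-prime

  prime∣cube⇒∣ : ∀ n → p ℕ.∣ n ℕ.* n ℕ.* n → p ℕ.∣ n
  prime∣cube⇒∣ n p∣n³ with euclidsLemma (n ℕ.* n) n p-prime p∣n³
  ... | inj₁ p∣n² = reduce (euclidsLemma n n p-prime p∣n²)
  ... | inj₂ p∣n  = p∣n

  ∣cube⇒^3∣cube : ∀ n → p ℕ.∣ n ℕ.* n ℕ.* n → p ^ 3 ℕ.∣ n ℕ.* n ℕ.* n
  ∣cube⇒^3∣cube n p∣n³ with prime∣cube⇒∣ n p∣n³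
  ... | divides k refl = subst (p ^ 3 ℕ.∣_) (sym ([k*p]³≡p^3*k³ k p)) (ℕ.m∣m*n _)

  cofactor⇒IsVal : ∀ {a} e → ¬ p ℕ.∣ a → IsVal p (+ (a ℕ.* p ^ e)) e
  cofactor⇒IsVal {a} e p∤a = ℕ.n∣m*n a , p∤a ∘ ℕ.*-cancelʳ-∣ (p ^ e) {{m^n≢0 p e}}

  IsVal-*ℕ : ∀ a b e f → IsVal p (+ a) e → IsVal p (+ b) f → IsVal p (+ (a ℕ.* b)) (e + f)
  IsVal-*ℕ _ _ e f (divides a refl , ∤a) (divides b refl , ∤b) =
    subst (λ n → IsVal p (+ n) (e + f)) (sym regroup) (cofactor⇒IsVal (e + f) p∤ab)
    where
    regroup : a ℕ.* p ^ e ℕ.* (b ℕ.* p ^ f) ≡ a ℕ.* b ℕ.* p ^ (e + f)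
    regroup = trans ([m*n]*[o*p]≡[m*o]*[n*p] a (p ^ e) b (p ^ f))
                    (cong (a ℕ.* b ℕ.*_) (sym (^-distribˡ-+-* p e f)))
    p∤ab : ¬ p ℕ.∣ a ℕ.* b
    p∤ab = [ p^[1+e]∤a*p^e⇒p∤a e ∤a , p^[1+e]∤a*p^e⇒p∤a f ∤b ]′ ∘ euclidsLemma a b p-prime

  IsVal-cancel : ∀ a k e → IsVal p (+ (p ^ k ℕ.* a)) (k + e) → IsVal p (+ a) e
  IsVal-cancel a k e (p^[k+e]∣ , p^[k+e+1]∤) =
      ℕ.*-cancelˡ-∣ (p ^ k) {{m^n≢0 p k}} (subst (ℕ._∣ p ^ k ℕ.* a) (^-distribˡ-+-* p k e) p^[k+e]∣)
    , p^[k+e+1]∤ ∘ subst (ℕ._∣ p ^ k ℕ.* a) (trans (sym (^-distribˡ-+-* p k (suc e))) (cong (p ^_) (+-suc k e)))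
                 ∘ ℕ.*-monoʳ-∣ (p ^ k)

  3∣exponent-of-cube : ∀ e n → IsVal p (+ (n ℕ.* n ℕ.* n)) e → 3 ℕ.∣ e
  3∣exponent-of-cube 0 _ _ = ℕ._∣0 3
  3∣exponent-of-cube 1 n (p∣n³ , p²∤n³) = contradiction
    (ℕ.∣-trans (^-monoʳ-∣ p {2} {3} (s≤s (s≤s z≤n))) (∣cube⇒^3∣cube n (ℕ.∣-trans (ℕ.m∣m*n 1) p∣n³)))
    p²∤n³
  3∣exponent-of-cube 2 n (p²∣n³ , p³∤n³) = contradiction
    (∣cube⇒^3∣cube n (ℕ.∣-trans (ℕ.m∣m*n (p ^ 1)) p²∣n³))
    p³∤n³
  3∣exponent-of-cube (suc (suc (suc e))) n v@(p^[3+e]∣n³ , _)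
    with prime∣cube⇒∣ n (ℕ.∣-trans (ℕ.m∣m*n (p ^ (2 + e))) p^[3+e]∣n³)
  ... | divides k refl = ℕ.∣m∣n⇒∣m+n ℕ.∣-refl (3∣exponent-of-cube e k
          (IsVal-cancel (k ℕ.* k ℕ.* k) 3 e (subst (λ n → IsVal p (+ n) (3 + e)) ([k*p]³≡p^3*k³ k p) v)))

  IsVal-* : ∀ x y e f → IsVal p x e → IsVal p y f → IsVal p (x * y) (e + f)
  IsVal-* x y e f vx vy =
    subst (λ n → IsVal p (+ n) (e + f)) (sym (ℤ.abs-* x y)) (IsVal-*ℕ ℤ.∣ x ∣ ℤ.∣ y ∣ e f vx vy)

  IsVal-cube⇒3∣ : ∀ m e → IsVal p (m * m * m) e → 3 ℕ.∣ e
  IsVal-cube⇒3∣ m e = 3∣exponent-of-cube e (ℤ.∣ m ∣) ∘ subst (λ n → IsVal p (+ n) e) ∣m³∣≡∣m∣³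
    where
    ∣m³∣≡∣m∣³ : ℤ.∣ m * m * m ∣ ≡ ℤ.∣ m ∣ ℕ.* ℤ.∣ m ∣ ℕ.* ℤ.∣ m ∣
    ∣m³∣≡∣m∣³ = trans (ℤ.abs-* (m * m) m) (cong (ℕ._* ℤ.∣ m ∣) (ℤ.abs-* m m))

IsVal-neg : ∀ p x e → IsVal p x e → IsVal p (ℤ.- x) e
IsVal-neg p x e = subst (λ n → IsVal p (+ n) e) (sym (ℤ.∣-i∣≡∣i∣ x))

IsVal-+ : ∀ p x y e → IsVal p x e → (+ (p ^ suc e)) ∣ y → IsVal p (x ℤ.+ y) e
IsVal-+ p x y e (p^e∣x , p^[1+e]∤x) p^[1+e]∣y = p^e∣x+y , p^[1+e]∤x ∘ p^[1+e]∣x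
  where
  p^e∣y : (+ (p ^ e)) ∣ y
  p^e∣y = ℕ.∣-trans (ℕ.n∣m*n p) p^[1+e]∣y
  p^e∣x+y : (+ (p ^ e)) ∣ x ℤ.+ y
  p^e∣x+y = ℤ.∣⇒∣ᵤ {+ (p ^ e)} {x ℤ.+ y}
    (ℤ.∣m∣n⇒∣m+n (ℤ.∣ᵤ⇒∣ {+ (p ^ e)} {x} p^e∣x) (ℤ.∣ᵤ⇒∣ {+ (p ^ e)} {y} p^e∣y))
  p^[1+e]∣x : (+ (p ^ suc e)) ∣ x ℤ.+ y → (+ (p ^ suc e)) ∣ x
  p^[1+e]∣x p^[1+e]∣x+y = ℤ.∣⇒∣ᵤ {+ (p ^ suc e)} {x}
    (ℤ.∣m+n∣n⇒∣m (ℤ.∣ᵤ⇒∣ {+ (p ^ suc e)} {x ℤ.+ y} p^[1+e]∣x+y) (ℤ.∣ᵤ⇒∣ {+ (p ^ suc e)} {y} p^[1+e]∣y))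

∤⇒IsVal-0 : ∀ p x → ¬ (+ p) ∣ x → IsVal p x 0
∤⇒IsVal-0 p x p∤x = ℕ.1∣ ℤ.∣ x ∣ , p∤x ∘ ℕ.∣-trans (ℕ.m∣m*n 1)

p^k∣x⇒p^[k+k]∣x*x : ∀ p k x → (+ (p ^ k)) ∣ x → (+ (p ^ (k + k))) ∣ x * x
p^k∣x⇒p^[k+k]∣x*x p k x p^k∣x =
  subst₂ ℕ._∣_ (sym (^-distribˡ-+-* p k k)) (sym (ℤ.abs-* x x)) (ℕ.*-pres-∣ p^k∣x p^k∣x)

p^[1+k]∣x⇒p^[1+2k]∣x*x : ∀ p k x → (+ (p ^ suc k)) ∣ x → (+ (p ^ suc (k + k))) ∣ x * x
p^[1+k]∣x⇒p^[1+2k]∣x*x p k x p^[1+k]∣x =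
  ℕ.∣-trans (^-monoʳ-∣ p (s≤s (+-monoʳ-≤ k (n≤1+n k)))) (p^k∣x⇒p^[k+k]∣x*x p (suc k) x p^[1+k]∣x)

p^k∣x⇒p∣y⇒p^[1+2k]∣x*x*y : ∀ p k x y → (+ (p ^ k)) ∣ x → (+ p) ∣ y → (+ (p ^ suc (k + k))) ∣ x * x * y
p^k∣x⇒p∣y⇒p^[1+2k]∣x*x*y p k x y p^k∣x p∣y =
  subst₂ ℕ._∣_ (*-comm (p ^ (k + k)) p) (sym (ℤ.abs-* (x * x) y))
    (ℕ.*-pres-∣ (p^k∣x⇒p^[k+k]∣x*x p k x p^k∣x) p∣y)

∣x⇒∣x*y : ∀ k x y → k ∣ x → k ∣ x * y
∣x⇒∣x*y k x y k∣x = subst (ℤ.∣ k ∣ ℕ.∣_) (sym (ℤ.abs-* x y)) (ℕ.∣m⇒∣m*n ℤ.∣ y ∣ k∣x)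

exponent-multiple-of-3⇒≥3 : ∀ p x e → (+ p) ∣ x → IsVal p x e → 3 ℕ.∣ e → 3 ≤ e
exponent-multiple-of-3⇒≥3 p _ 0 p∣x (_ , p∤x) _ = contradiction (ℕ.∣-trans (ℕ.∣-reflexive (*-identityʳ p)) p∣x) p∤x
exponent-multiple-of-3⇒≥3 _ _ (suc e) _ _ 3∣e = ℕ.∣⇒≤ 3∣e

cTest⇒odd : ∀ {D g p} → cTest D g p ≡ true → ¬ 2 ℕ.∣ p
cTest⇒odd {p = p} _ 2∣p with prime? p | 2 ∣? p
cTest⇒odd () _ | yes _ | yes _
cTest⇒odd () _ | no _  | _
... | yes _ | no 2∤p = 2∤p 2∣p

odd-prime-divisor⇒cTest : ∀ {D g p} → Prime p → ¬ 2 ℕ.∣ p → p ℕ.∣ g → ¬ p ℕ.∣ D → cTest D g p ≡ true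
odd-prime-divisor⇒cTest {D} {g} {p} p-prime 2∤p p∣g p∤D with prime? p | 2 ∣? p | p ∣? g | p ∣? D
... | no ¬p-prime | _       | _      | _       = contradiction p-prime ¬p-prime
... | yes _       | yes 2∣p | _      | _       = contradiction 2∣p 2∤p
... | yes _       | no _    | no p∤g | _       = contradiction p∣g p∤g
... | yes _       | no _    | yes _  | yes p∣D = contradiction p∣D p∤D
... | yes _       | no _    | yes _  | no _    = refl

cProd-odd : ∀ D g n → ¬ 2 ℕ.∣ cProd D g n
cProd-odd D g 0 2∣1 = contradiction (ℕ.∣1⇒≡1 2∣1) λ ()
cProd-odd D g (suc n) 2∣cProd with cTest D g n in cTest≡
... | true with euclidsLemma n (cProd D g n) prime[2] 2∣cProd
...   | inj₁ 2∣n    = cTest⇒odd cTest≡ 2∣n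
...   | inj₂ 2∣rest = cProd-odd D g n 2∣rest
cProd-odd D g (suc n) 2∣cProd | false with euclidsLemma 1 (cProd D g n) prime[2] 2∣cProd
...   | inj₁ 2∣1    = contradiction (ℕ.∣1⇒≡1 2∣1) λ ()
...   | inj₂ 2∣rest = cProd-odd D g n 2∣rest

cTest⇒∣cProd : ∀ D g {p} n → cTest D g p ≡ true → p < n → p ℕ.∣ cProd D g n
cTest⇒∣cProd D g {p} (suc n) cTest≡true p<1+n with m<1+n⇒m<n∨m≡n p<1+n
... | inj₁ p<n  = ℕ.∣n⇒∣m*n (if cTest D g n then n else 1) (cTest⇒∣cProd D g n cTest≡true p<n)
... | inj₂ refl rewrite cTest≡true = ℕ.∣m⇒∣m*n (cProd D g p) ℕ.∣-refl

Cof-odd : ∀ D A B → ¬ 2 ℕ.∣ Cof D A B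
Cof-odd D A B = cProd-odd D ℤ.∣ gcd A B ∣ (suc ℤ.∣ gcd A B ∣)

odd-prime∣Cof : ∀ D A B {p} → .{{NonZero ℤ.∣ gcd A B ∣}} →
                Prime p → ¬ 2 ℕ.∣ p → (+ p) ∣ gcd A B → ¬ p ℕ.∣ D → p ℕ.∣ Cof D A B
odd-prime∣Cof D A B p-prime 2∤p p∣g p∤D =
  cTest⇒∣cProd D ℤ.∣ gcd A B ∣ (suc ℤ.∣ gcd A B ∣) (odd-prime-divisor⇒cTest p-prime 2∤p p∣g p∤D) (s≤s (ℕ.∣⇒≤ p∣g))

q∣D⊎q∣Cof : ∀ D A B {q} → .{{NonZero ℤ.∣ gcd A B ∣}} → Prime q → (+ q) ∣ gcd A B →
            q > 2 ⊎ (q ≡ 2 × (+ 2) ∣ (+ D)) → q ℕ.∣ D ⊎ q ℕ.∣ Cof D A B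
q∣D⊎q∣Cof D A B {q} q-prime q∣g q>2⊎2∣D with q ∣? D
... | yes q∣D = inj₁ q∣D
... | no  q∤D = inj₂ (odd-prime∣Cof D A B q-prime (q-odd q>2⊎2∣D) q∣g q∤D)
  where
  q-odd : q > 2 ⊎ (q ≡ 2 × (+ 2) ∣ (+ D)) → ¬ 2 ℕ.∣ q
  q-odd (inj₁ q>2) 2∣q with prime⇒irreducible q-prime 2∣q
  ... | inj₁ ()
  ... | inj₂ refl = contradiction q>2 (<-irrefl refl)
  q-odd (inj₂ (refl , 2∣D)) _ = q∤D 2∣D

module NormIsCube {D : ℕ} {A B m : ℤ} (norm≡cube : norm D A B ≡ m * m * m)
         {q : ℕ} (q-prime : Prime q) (q³∤gcd : ¬ (+ (q ^ 3)) ∣ gcd A B)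
         (q∣A : (+ q) ∣ A) (q∣B : (+ q) ∣ B) where

  private
    3∣half-exponent-of-norm : ∀ {e} → IsVal q (norm D A B) (e + e) → 3 ℕ.∣ e
    3∣half-exponent-of-norm {e} v =
      3∣n+n⇒3∣n e (IsVal-cube⇒3∣ q-prime m (e + e) (subst (λ z → IsVal q z (e + e)) norm≡cube v))

    q³∣A×q³∣B⇒⊥ : (+ (q ^ 3)) ∣ A → (+ (q ^ 3)) ∣ B → ⊥
    q³∣A×q³∣B⇒⊥ q³∣A q³∣B = q³∤gcd (gcd-greatest {A} {B} {+ (q ^ 3)} q³∣A q³∣B)

  ¬v[A²]<v[B²D] : ∀ s → IsVal q A s → (+ (q ^ s)) ∣ B → q ℕ.∣ D ⊎ (+ (q ^ suc s)) ∣ B → ⊥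
  ¬v[A²]<v[B²D] s vA q^s∣B q∣D⊎q^[1+s]∣B = q³∣A×q³∣B⇒⊥ (ℕ.∣-trans q³∣q^s (proj₁ vA)) (ℕ.∣-trans q³∣q^s q^s∣B)
    where
    q^[1+2s]∣B²D : (+ (q ^ suc (s + s))) ∣ B * B * + D
    q^[1+2s]∣B²D = [ p^k∣x⇒p∣y⇒p^[1+2k]∣x*x*y q s B (+ D) q^s∣B
                   , ∣x⇒∣x*y (+ (q ^ suc (s + s))) (B * B) (+ D) ∘ p^[1+k]∣x⇒p^[1+2k]∣x*x q s B
                   ]′ q∣D⊎q^[1+s]∣B
    v-norm : IsVal q (norm D A B) (s + s)
    v-norm = IsVal-+ q (A * A) (ℤ.- (B * B * + D)) (s + s) (IsVal-* q-prime A A s s vA vA)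
               (subst (q ^ suc (s + s) ℕ.∣_) (sym (ℤ.∣-i∣≡∣i∣ (B * B * + D))) q^[1+2s]∣B²D)
    q³∣q^s : q ^ 3 ℕ.∣ q ^ s
    q³∣q^s = ^-monoʳ-∣ q (exponent-multiple-of-3⇒≥3 q A s q∣A vA (3∣half-exponent-of-norm v-norm))

  ¬v[B²D]<v[A²] : ∀ r → IsVal q B r → ¬ q ℕ.∣ D → (+ (q ^ suc r)) ∣ A → ⊥
  ¬v[B²D]<v[A²] r vB q∤D q^[1+r]∣A =
    q³∣A×q³∣B⇒⊥ (ℕ.∣-trans q³∣q^r (ℕ.∣-trans (^-monoʳ-∣ q (n≤1+n r)) q^[1+r]∣A)) (ℕ.∣-trans q³∣q^r (proj₁ vB))
    where
    v-B²D : IsVal q (B * B * + D) (r + r)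
    v-B²D = subst (IsVal q (B * B * + D)) (+-identityʳ (r + r))
              (IsVal-* q-prime (B * B) (+ D) (r + r) 0 (IsVal-* q-prime B B r r vB vB) (∤⇒IsVal-0 q (+ D) q∤D))
    v-norm : IsVal q (norm D A B) (r + r)
    v-norm = subst (λ z → IsVal q z (r + r)) (ℤ.+-comm (ℤ.- (B * B * + D)) (A * A))
               (IsVal-+ q (ℤ.- (B * B * + D)) (A * A) (r + r) (IsVal-neg q (B * B * + D) (r + r) v-B²D)
                  (p^[1+k]∣x⇒p^[1+2k]∣x*x q r A q^[1+r]∣A))
    q³∣q^r : q ^ 3 ℕ.∣ q ^ r
    q³∣q^r = ^-monoʳ-∣ q (exponent-multiple-of-3⇒≥3 q B r q∣B vB (3∣half-exponent-of-norm v-norm))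

module Cofactor {D : ℕ} {A B B' m : ℤ} {C : ℕ} (norm≡cube : norm D A B ≡ m * m * m)
         (cubefree : ∀ p → Prime p → ¬ (+ (p ^ 3)) ∣ gcd A B) (B≡CB' : B ≡ + C * B')
         {q : ℕ} (q-prime : Prime q) (q∣gcd : (+ q) ∣ gcd A B')
         {s r : ℕ} (vA : IsVal q A s) (vB' : IsVal q B' r) where

  private
    ∣B∣≡C*∣B'∣ : ℤ.∣ B ∣ ≡ C ℕ.* ℤ.∣ B' ∣
    ∣B∣≡C*∣B'∣ = trans (cong ℤ.∣_∣ B≡CB') (ℤ.abs-* (+ C) B')

    ∣B'⇒∣B : ∀ {k} → k ℕ.∣ ℤ.∣ B' ∣ → k ℕ.∣ ℤ.∣ B ∣
    ∣B'⇒∣B = subst (_ ℕ.∣_) (sym ∣B∣≡C*∣B'∣) ∘ ℕ.∣n⇒∣m*n C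

    q^k∣B' : ∀ {k} → k ≤ r → (+ (q ^ k)) ∣ B'
    q^k∣B' k≤r = ℕ.∣-trans (^-monoʳ-∣ q k≤r) (proj₁ vB')

    q^k∣B : ∀ {k} → k ≤ r → (+ (q ^ k)) ∣ B
    q^k∣B = ∣B'⇒∣B ∘ q^k∣B'

    q^[1+k]∣B : ∀ {k} → k ≤ r → q ℕ.∣ C → (+ (q ^ suc k)) ∣ B
    q^[1+k]∣B {k} k≤r q∣C = subst (q ^ suc k ℕ.∣_) (sym ∣B∣≡C*∣B'∣) (ℕ.*-pres-∣ q∣C (q^k∣B' k≤r))

  q∣A : (+ q) ∣ A
  q∣A = ℕ.∣-trans q∣gcd (gcd[i,j]∣i A B')

  q∣B : (+ q) ∣ B
  q∣B = ∣B'⇒∣B (ℕ.∣-trans q∣gcd (gcd[i,j]∣j A B'))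

  open NormIsCube {D} {A} {B} {m} norm≡cube q-prime (cubefree q q-prime) q∣A q∣B

  s>r : q ℕ.∣ D ⊎ q ℕ.∣ C → s > r
  s>r q∣D⊎q∣C = ≰⇒> λ s≤r → ¬v[A²]<v[B²D] s vA (q^k∣B s≤r) (map₂ (q^[1+k]∣B s≤r) q∣D⊎q∣C)

  s≡r : ¬ q ℕ.∣ D → ¬ q ℕ.∣ C → s ≡ r
  s≡r q∤D q∤C with <-cmp s r
  ... | tri< s<r _ _ = ⊥-elim (¬v[A²]<v[B²D] s vA (q^k∣B (<⇒≤ s<r)) (inj₂ (q^k∣B s<r)))
  ... | tri≈ _ s≡r _ = s≡r
  ... | tri> _ _ r<s = ⊥-elim (¬v[B²D]<v[A²] r vB q∤D (ℕ.∣-trans (^-monoʳ-∣ q r<s) (proj₁ vA)))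
    where
    vB : IsVal q B r
    vB = subst (λ x → IsVal q x r) (sym B≡CB') (IsVal-* q-prime (+ C) B' 0 r (∤⇒IsVal-0 q (+ C) q∤C) vB')

lemma2p1 : (D : ℕ) → D > 1 → Squarefree D →
    (A B : ℤ) → InS D A B →
    (B' : ℤ) → B ≡ + (Cof D A B) * B' →
    (q : ℕ) → Prime q → (+ q) ∣ gcd A B' →
    (s r : ℕ) → IsVal q A s → IsVal q B' r →
    ((q > 2 ⊎ (q ≡ 2 × (+ 2) ∣ (+ D))) → s > r) ×
    ((q ≡ 2 × ¬ ((+ 2) ∣ (+ D))) → s ≡ r)
lemma2p1 D _ _ A B ((m , norm≡cube) , _ , cubefree) B' B≡CB' q q-prime q∣gcd s r vA vB' =
  s>r ∘ q∣D⊎q∣Cof D A B q-prime (gcd-greatest {A} {B} {+ q} q∣A q∣B) ,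
  λ (q≡2 , 2∤D) → s≡r (subst (λ p → ¬ p ℕ.∣ D) (sym q≡2) 2∤D)
                      (subst (λ p → ¬ p ℕ.∣ Cof D A B) (sym q≡2) (Cof-odd D A B))
  where
  open Cofactor {D} {A} {B} {B'} {m} {Cof D A B} norm≡cube cubefree B≡CB' q-prime q∣gcd {s} {r} vA vB'
  instance
    gcd≢0 : NonZero ℤ.∣ gcd A B ∣
    gcd≢0 = ≢-nonZero λ gcd≡0 → cubefree 2 prime[2] (subst (8 ℕ.∣_) (sym gcd≡0) (ℕ._∣0 8))
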